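{- Let $z,k$ be positive integers and let $w_1,w_2$ be strings whose periods do not exceed $\frac{z}{2}$. If $w_1\neq w_2$ and $|w_1|=|w_2|\ge z(k+1)$, then $w_1$ and $w_2$ differ in at least $k+1$ positions.
   Context: A positive integer $\alpha$ is a period of a string $s$ if $s[i]=s[i+\alpha]$ for all $1\le i\le |s|-\alpha$; the period of $s$ is its smallest period. -}

module Defs where

open import Data.Nat using (ℕ; zero; suc; _+_; _*_; _≤_; _<_)
open import Data.Fin using (Fin; toℕ)
open import Data.Vec using (Vec; lookup)
open import Data.List using (List; length; filter)
open import Data.List using () renaming (allFin to allFinL)
open import Data.Product using (Σ; _×_; _,_)
open import Relation.Binary.PropositionalEquality using (_≡_)
open import Relation.Binary.Definitions using (DecidableEquality)
open import Relation.Nullary using (¬_; ¬?)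

String : Set → ℕ → Set
String A n = Vec A n

IsPeriod : {A : Set} {n : ℕ} → String A n → ℕ → Set
IsPeriod {A} {n} s α =
  (1 ≤ α) × ((i j : Fin n) → toℕ j ≡ toℕ i + α → lookup s i ≡ lookup s j)

IsThePeriod : {A : Set} {n : ℕ} → String A n → ℕ → Set
IsThePeriod s p = IsPeriod s p × ((α : ℕ) → IsPeriod s α → p ≤ α)

hamming : {A : Set} → DecidableEquality A → {n : ℕ} → String A n → String A n → ℕ
hamming _≟_ {n} s t =
  length (filter (λ i → ¬? (lookup s i ≟ lookup t i)) (allFinL n))

-- Cut the first z(k+1) positions into k+1 blocks of length z; it suffices that
-- every block contains a mismatch. Suppose w₁ and w₂ agree on a window of
-- length z ≥ p₁ + p₂. On the window w₁[x] = w₂[x] = w₂[x+p₂] = w₁[x+p₂], and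
-- shifting by the period p₁ of w₁ carries this identity to every x, so p₂ is a
-- period of w₁ and p₁ ≤ p₂ by minimality; symmetrically p₂ ≤ p₁. Shifting by the
-- common period then carries the agreement on the window to every position,
-- so w₁ = w₂.
module Submission where

open import Defs
open import Data.Bool using (true; false; if_then_else_)
open import Data.Nat using (ℕ; zero; suc; _+_; _*_; _∸_; _≤_; _<_; z≤n; _<?_; _≤?_)
open import Data.Nat.Properties
open import Data.Nat.Induction using (<-rec)
open import Data.Fin using (Fin; toℕ; fromℕ<)
import Data.Fin as Fin
open import Data.Fin.Properties using (toℕ-fromℕ<; fromℕ<-toℕ; toℕ-injective; toℕ<n)
open import Data.Vec using (Vec; lookup)
open import Data.Vec.Properties using (tabulate∘lookup; tabulate-cong)
open import Data.List using (List; _∷_; length; filter; tabulate)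
open import Data.Product using (_,_)
open import Data.Sum using (inj₁; inj₂)
open import Data.Empty using (⊥-elim)
open import Function using (id; _∘_)
open import Relation.Binary.PropositionalEquality
open import Relation.Binary.Definitions using (DecidableEquality)
open import Relation.Nullary using (¬_; ¬?; yes; no; does; contradiction)
open import Relation.Nullary.Decidable using (decidable-stable)
open import Relation.Unary using (Pred; Decidable)
open import Level using (Level)
open import Algebra.Properties.CommutativeSemigroup +-commutativeSemigroup
  using (xy∙z≈xz∙y)

module _ (P : ℕ → Set) {a p : ℕ} (1≤p : 1 ≤ p)
         (window   : ∀ x → a ≤ x → x < a + p → P x)
         (forward  : ∀ x → P x → P (x + p))
         (backward : ∀ x → x < a → P (x + p) → P x) where

  private
    above : ∀ x → a ≤ x → P x
    above = <-rec (λ x → a ≤ x → P x) step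
      where
      step : ∀ x → (∀ {y} → y < x → a ≤ y → P y) → a ≤ x → P x
      step x rec a≤x with x <? a + p
      ... | yes x<a+p = window x a≤x x<a+p
      ... | no x≮a+p = subst P (m∸n+n≡m p≤x)
              (forward (x ∸ p) (rec (∸-monoʳ-< 1≤p p≤x) (m+n≤o⇒m≤o∸n a a+p≤x)))
        where
        a+p≤x = ≮⇒≥ x≮a+p
        p≤x = m+n≤o⇒n≤o a a+p≤x

    below : ∀ m x → a ≤ m + x → P x
    below zero x a≤x = above x a≤x
    below (suc m) x a≤1+m+x with a ≤? x
    ... | yes a≤x = above x a≤x
    ... | no a≰x = backward x (≰⇒> a≰x) (below m (x + p)
            (≤-trans a≤1+m+x (≤-trans (≤-reflexive (sym (+-suc m x)))
                                       (+-monoʳ-≤ m (m<m+n x 1≤p)))))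

  window-rec : ∀ x → P x
  window-rec x = below a x (m≤m+n a x)

module _ {A : Set} {n : ℕ} where

  Agree : Vec A n → Vec A n → ℕ → ℕ → Set
  Agree s t x y = ∀ (i j : Fin n) → toℕ i ≡ x → toℕ j ≡ y → lookup s i ≡ lookup t j

  Periodic : Vec A n → ℕ → Set
  Periodic s α = ∀ x → Agree s s x (x + α)

  AgreeOn : Vec A n → Vec A n → ℕ → ℕ → Set
  AgreeOn s t a m = ∀ (i : Fin n) → a ≤ toℕ i → toℕ i < a + m → lookup s i ≡ lookup t i

  isPeriod⇒periodic : ∀ {s α} → IsPeriod s α → Periodic s α
  isPeriod⇒periodic (_ , per) x i j refl j≡x+α = per i j j≡x+α

  periodic⇒isPeriod : ∀ {s α} → 1 ≤ α → Periodic s α → IsPeriod s α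
  periodic⇒isPeriod 1≤α per = 1≤α , λ i j → per (toℕ i) i j refl

  private
    bounded : ∀ (i : Fin n) {x} → toℕ i ≡ x → x < n
    bounded i refl = toℕ<n i

  module _ {s t : Vec A n} {p : ℕ} (ps : Periodic s p) (pt : Periodic t p) where

    agree-shift : ∀ {x y} → Agree s t x y → Agree s t (x + p) (y + p)
    agree-shift {x} {y} st i j i≡x+p j≡y+p =
      trans (sym (ps x i′ i (toℕ-fromℕ< x<n) i≡x+p))
        (trans (st i′ j′ (toℕ-fromℕ< x<n) (toℕ-fromℕ< y<n))
               (pt y j′ j (toℕ-fromℕ< y<n) j≡y+p))
      where
      x<n = ≤-<-trans (m≤m+n x p) (bounded i i≡x+p)
      y<n = ≤-<-trans (m≤m+n y p) (bounded j j≡y+p)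
      i′ = fromℕ< x<n
      j′ = fromℕ< y<n

    agree-unshift : ∀ {x y} → x + p < n → y + p < n →
      Agree s t (x + p) (y + p) → Agree s t x y
    agree-unshift {x} {y} x+p<n y+p<n st i j i≡x j≡y =
      trans (ps x i i′ i≡x (toℕ-fromℕ< x+p<n))
        (trans (st i′ j′ (toℕ-fromℕ< x+p<n) (toℕ-fromℕ< y+p<n))
               (sym (pt y j j′ j≡y (toℕ-fromℕ< y+p<n))))
      where
      i′ = fromℕ< x+p<n
      j′ = fromℕ< y+p<n

    agree-from-window : ∀ {a d} → 1 ≤ p → a + p + d ≤ n →
      (∀ x → a ≤ x → x < a + p → Agree s t x (x + d)) → ∀ x → Agree s t x (x + d)
    agree-from-window {a} {d} 1≤p a+p+d≤n window =
      window-rec (λ x → Agree s t x (x + d)) 1≤p window forward backward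
      where
      forward : ∀ x → Agree s t x (x + d) → Agree s t (x + p) (x + p + d)
      forward x st = subst (Agree s t (x + p)) (xy∙z≈xz∙y x d p) (agree-shift st)

      backward : ∀ x → x < a → Agree s t (x + p) (x + p + d) → Agree s t x (x + d)
      backward x x<a st = agree-unshift (≤-<-trans (m≤m+n (x + p) d) x+p+d<n)
        (subst (_< n) (xy∙z≈xz∙y x p d) x+p+d<n)
        (subst (Agree s t (x + p)) (xy∙z≈xz∙y x p d) st)
        where
        x+p+d<n = <-≤-trans (+-monoˡ-< d (+-monoˡ-< p x<a)) a+p+d≤n

  module _ {s t : Vec A n} {a m : ℕ} (a+m≤n : a + m ≤ n) (s≈t : AgreeOn s t a m) where

    periodic-transfer : ∀ {q r} → 1 ≤ q → q + r ≤ m → Periodic s q → Periodic t r →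
      Periodic s r
    periodic-transfer {q} {r} 1≤q q+r≤m ps pt =
      agree-from-window {s = s} {t = s} ps ps 1≤q (≤-trans a+q+r≤a+m a+m≤n) window
      where
      a+q+r≤a+m : a + q + r ≤ a + m
      a+q+r≤a+m = ≤-trans (≤-reflexive (+-assoc a q r)) (+-monoʳ-≤ a q+r≤m)

      window : ∀ x → a ≤ x → x < a + q → Agree s s x (x + r)
      window x a≤x x<a+q i j refl j≡x+r =
        trans (s≈t i a≤x (<-≤-trans x<a+q (≤-trans (m≤m+n (a + q) r) a+q+r≤a+m)))
          (trans (pt x i j refl j≡x+r)
                 (sym (s≈t j (subst (a ≤_) (sym j≡x+r) (≤-trans a≤x (m≤m+n x r)))
                        (subst (_< a + m) (sym j≡x+r)
                          (<-≤-trans (+-monoˡ-< r x<a+q) a+q+r≤a+m)))))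

  agreeOn-sym : ∀ {s t a m} → AgreeOn s t a m → AgreeOn t s a m
  agreeOn-sym s≈t i a≤i i<a+m = sym (s≈t i a≤i i<a+m)

  agreeOn⇒period-≤ : ∀ {s t a m p₁ p₂} → a + m ≤ n → AgreeOn s t a m →
    IsThePeriod s p₁ → IsPeriod t p₂ → p₁ + p₂ ≤ m → p₁ ≤ p₂
  agreeOn⇒period-≤ {s} {t} a+m≤n s≈t (s-per@(1≤p₁ , _) , s-min) t-per@(1≤p₂ , _) p₁+p₂≤m =
    s-min _ (periodic⇒isPeriod {s = s} 1≤p₂
      (periodic-transfer {s = s} {t = t} a+m≤n s≈t 1≤p₁ p₁+p₂≤m
        (isPeriod⇒periodic {s = s} s-per) (isPeriod⇒periodic {s = t} t-per)))

  agreeOn-period⇒≡ : ∀ {s t a m p} → a + m ≤ n → AgreeOn s t a m → 1 ≤ p → p ≤ m →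
    Periodic s p → Periodic t p → s ≡ t
  agreeOn-period⇒≡ {s} {t} {a} {m} {p} a+m≤n s≈t 1≤p p≤m ps pt =
    trans (sym (tabulate∘lookup s))
      (trans (tabulate-cong (λ i → everywhere (toℕ i) i i refl (sym (+-identityʳ _))))
             (tabulate∘lookup t))
    where
    a+p≤a+m : a + p ≤ a + m
    a+p≤a+m = +-monoʳ-≤ a p≤m

    window : ∀ x → a ≤ x → x < a + p → Agree s t x (x + 0)
    window x a≤x x<a+p i j refl j≡x+0 =
      trans (s≈t i a≤x (<-≤-trans x<a+p a+p≤a+m))
            (cong (lookup t) (toℕ-injective (trans (sym (+-identityʳ x)) (sym j≡x+0))))

    everywhere : ∀ x → Agree s t x (x + 0)
    everywhere = agree-from-window {s = s} {t = t} ps pt 1≤p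
      (≤-trans (≤-reflexive (+-identityʳ (a + p))) (≤-trans a+p≤a+m a+m≤n)) window

  agreeOn⇒≡ : ∀ {s t a m p₁ p₂} → a + m ≤ n → AgreeOn s t a m →
    IsThePeriod s p₁ → IsThePeriod t p₂ → p₁ + p₂ ≤ m → s ≡ t
  agreeOn⇒≡ {s} {t} {m = m} {p₁} {p₂} a+m≤n s≈t
            s-the@(s-per@(1≤p₁ , _) , _) t-the@(t-per , _) p₁+p₂≤m =
    agreeOn-period⇒≡ a+m≤n s≈t 1≤p₁ (m+n≤o⇒m≤o p₁ p₁+p₂≤m) (isPeriod⇒periodic {s = s} s-per)
      (subst (Periodic t) p₂≡p₁ (isPeriod⇒periodic {s = t} t-per))
    where
    p₂≡p₁ : p₂ ≡ p₁
    p₂≡p₁ = ≤-antisym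
      (agreeOn⇒period-≤ {s = t} {t = s} a+m≤n (agreeOn-sym {s = s} {t = t} s≈t) t-the s-per
        (subst (_≤ m) (+-comm p₁ p₂) p₁+p₂≤m))
      (agreeOn⇒period-≤ {s = s} {t = t} a+m≤n s≈t s-the t-per p₁+p₂≤m)

rangeSum : (ℕ → ℕ) → ℕ → ℕ → ℕ
rangeSum f c zero    = 0
rangeSum f c (suc m) = f c + rangeSum f (suc c) m

module _ (f : ℕ → ℕ) where

  rangeSum-+ : ∀ c m₁ m₂ → rangeSum f c (m₁ + m₂) ≡ rangeSum f c m₁ + rangeSum f (c + m₁) m₂
  rangeSum-+ c zero m₂ = cong (λ c′ → rangeSum f c′ m₂) (sym (+-identityʳ c))
  rangeSum-+ c (suc m₁) m₂ = begin
    f c + rangeSum f (suc c) (m₁ + m₂)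
      ≡⟨ cong (f c +_) (rangeSum-+ (suc c) m₁ m₂) ⟩
    f c + (rangeSum f (suc c) m₁ + rangeSum f (suc c + m₁) m₂)
      ≡⟨ +-assoc (f c) _ _ ⟨
    f c + rangeSum f (suc c) m₁ + rangeSum f (suc c + m₁) m₂
      ≡⟨ cong (λ c′ → f c + rangeSum f (suc c) m₁ + rangeSum f c′ m₂) (+-suc c m₁) ⟨
    f c + rangeSum f (suc c) m₁ + rangeSum f (c + suc m₁) m₂ ∎
    where open ≡-Reasoning

  rangeSum-monoʳ-≤ : ∀ c {m₁ m₂} → m₁ ≤ m₂ → rangeSum f c m₁ ≤ rangeSum f c m₂
  rangeSum-monoʳ-≤ c {m₁} {m₂} m₁≤m₂ = begin
    rangeSum f c m₁                                  ≤⟨ m≤m+n _ _ ⟩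
    rangeSum f c m₁ + rangeSum f (c + m₁) (m₂ ∸ m₁)  ≡⟨ rangeSum-+ c m₁ (m₂ ∸ m₁) ⟨
    rangeSum f c (m₁ + (m₂ ∸ m₁))                    ≡⟨ cong (rangeSum f c) (m+[n∸m]≡n m₁≤m₂) ⟩
    rangeSum f c m₂                                  ∎
    where open ≤-Reasoning

  rangeSum≡0⇒≡0 : ∀ c m {x} → rangeSum f c m ≡ 0 → c ≤ x → x < c + m → f x ≡ 0
  rangeSum≡0⇒≡0 c zero    _  c≤x x<c+0 = ⊥-elim (<⇒≱ (subst (_ <_) (+-identityʳ c) x<c+0) c≤x)
  rangeSum≡0⇒≡0 c (suc m) {x} sum≡0 c≤x x<c+1+m with c ≟ x
    where open Data.Nat using (_≟_)
  ... | yes refl = m+n≡0⇒m≡0 (f c) sum≡0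
  ... | no c≢x   = rangeSum≡0⇒≡0 (suc c) m (m+n≡0⇒n≡0 (f c) sum≡0)
                     (≤∧≢⇒< c≤x c≢x) (subst (x <_) (+-suc c m) x<c+1+m)

  rangeSum-blocks : ∀ z j → (∀ b → b < j → 1 ≤ rangeSum f (b * z) z) → j ≤ rangeSum f 0 (j * z)
  rangeSum-blocks z zero    _        = z≤n
  rangeSum-blocks z (suc j) positive = begin
    suc j
      ≡⟨ +-comm 1 j ⟩
    j + 1
      ≤⟨ +-mono-≤ (rangeSum-blocks z j (λ b → positive b ∘ m<n⇒m<1+n)) (positive j ≤-refl) ⟩
    rangeSum f 0 (j * z) + rangeSum f (j * z) z
      ≡⟨ rangeSum-+ 0 (j * z) z ⟨
    rangeSum f 0 (j * z + z)
      ≡⟨ cong (rangeSum f 0) (+-comm (j * z) z) ⟩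
    rangeSum f 0 (suc j * z) ∎
    where open ≤-Reasoning

module _ {n : ℕ} {ℓ : Level} {P : Pred (Fin n) ℓ} (P? : Decidable P) where

  indicator : ℕ → ℕ
  indicator x with x <? n
  ... | yes x<n = if does (P? (fromℕ< x<n)) then 1 else 0
  ... | no _    = 0

  indicator-toℕ : ∀ i → indicator (toℕ i) ≡ (if does (P? i) then 1 else 0)
  indicator-toℕ i with toℕ i <? n
  ... | yes i<n = cong (λ j → if does (P? j) then 1 else 0) (fromℕ<-toℕ i i<n)
  ... | no i≮n  = contradiction (toℕ<n i) i≮n

  indicator≡0⇒∁ : ∀ i → indicator (toℕ i) ≡ 0 → ¬ P i
  indicator≡0⇒∁ i ind≡0 with P? i | indicator-toℕ i
  ... | yes _ | ind≡1 = λ _ → 1+n≢0 (trans (sym ind≡1) ind≡0)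
  ... | no ¬p | _     = ¬p

  length-filter-∷ : ∀ i (is : List (Fin n)) →
    length (filter P? (i ∷ is)) ≡ (if does (P? i) then 1 else 0) + length (filter P? is)
  length-filter-∷ i is with does (P? i)
  ... | true  = refl
  ... | false = refl

  length-filter-tabulate : ∀ m c (f : Fin m → Fin n) → (∀ i → toℕ (f i) ≡ c + toℕ i) →
    length (filter P? (tabulate f)) ≡ rangeSum indicator c m
  length-filter-tabulate zero    c f _     = refl
  length-filter-tabulate (suc m) c f f-pos = begin
    length (filter P? (f Fin.zero ∷ tabulate (f ∘ Fin.suc)))
      ≡⟨ length-filter-∷ (f Fin.zero) _ ⟩
    (if does (P? (f Fin.zero)) then 1 else 0) + length (filter P? (tabulate (f ∘ Fin.suc)))
      ≡⟨ cong₂ _+_ (trans (sym (indicator-toℕ (f Fin.zero)))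
                          (cong indicator (trans (f-pos Fin.zero) (+-identityʳ c))))
                   (length-filter-tabulate m (suc c) (f ∘ Fin.suc)
                     (λ i → trans (f-pos (Fin.suc i)) (+-suc c (toℕ i)))) ⟩
    indicator c + rangeSum indicator (suc c) m ∎
    where open ≡-Reasoning

2*m≤o⇒2*n≤o⇒m+n≤o : ∀ {m n o} → 2 * m ≤ o → 2 * n ≤ o → m + n ≤ o
2*m≤o⇒2*n≤o⇒m+n≤o {m} {n} {o} 2m≤o 2n≤o with ≤-total m n
... | inj₁ m≤n = ≤-trans (+-monoˡ-≤ n m≤n) (subst (_≤ o) (cong (n +_) (+-identityʳ n)) 2n≤o)
... | inj₂ n≤m = ≤-trans (+-monoʳ-≤ m n≤m) (subst (_≤ o) (cong (m +_) (+-identityʳ m)) 2m≤o)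

proposition4 : {A : Set} (_≟_ : DecidableEquality A) (z k n : ℕ) →
    1 ≤ z → 1 ≤ k →
    (w₁ w₂ : String A n) →
    (p₁ : ℕ) → IsThePeriod w₁ p₁ → 2 * p₁ ≤ z →
    (p₂ : ℕ) → IsThePeriod w₂ p₂ → 2 * p₂ ≤ z →
    ¬ (w₁ ≡ w₂) → z * (k + 1) ≤ n →
    k + 1 ≤ hamming _≟_ w₁ w₂
proposition4 _≟_ z k n _ _ w₁ w₂ p₁ p₁-period 2p₁≤z p₂ p₂-period 2p₂≤z w₁≢w₂ z[k+1]≤n = begin
  k + 1                              ≤⟨ rangeSum-blocks mismatch z (k + 1) every-block-mismatches ⟩
  rangeSum mismatch 0 ((k + 1) * z)  ≤⟨ rangeSum-monoʳ-≤ mismatch 0 [k+1]z≤n ⟩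
  rangeSum mismatch 0 n              ≡⟨ length-filter-tabulate differ? n 0 id (λ _ → refl) ⟨
  hamming _≟_ w₁ w₂                  ∎
  where
  open ≤-Reasoning
  differ? : Decidable (λ i → ¬ lookup w₁ i ≡ lookup w₂ i)
  differ? i = ¬? (lookup w₁ i ≟ lookup w₂ i)

  mismatch : ℕ → ℕ
  mismatch = indicator differ?

  [k+1]z≤n : (k + 1) * z ≤ n
  [k+1]z≤n = ≤-trans (≤-reflexive (*-comm (k + 1) z)) z[k+1]≤n

  agree-on-block : ∀ b → rangeSum mismatch (b * z) z ≡ 0 → AgreeOn w₁ w₂ (b * z) z
  agree-on-block b no-mismatch i b*z≤i i<b*z+z = decidable-stable (lookup w₁ i ≟ lookup w₂ i)
    (indicator≡0⇒∁ differ? i (rangeSum≡0⇒≡0 mismatch (b * z) z no-mismatch b*z≤i i<b*z+z))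

  every-block-mismatches : ∀ b → b < k + 1 → 1 ≤ rangeSum mismatch (b * z) z
  every-block-mismatches b b<k+1 = n≢0⇒n>0 λ no-mismatch → w₁≢w₂
    (agreeOn⇒≡ block-fits (agree-on-block b no-mismatch) p₁-period p₂-period
      (2*m≤o⇒2*n≤o⇒m+n≤o {p₁} {p₂} 2p₁≤z 2p₂≤z))
    where
    block-fits : b * z + z ≤ n
    block-fits = ≤-trans (≤-reflexive (+-comm (b * z) z)) (≤-trans (*-monoˡ-≤ z b<k+1) [k+1]z≤n)
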